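{- Let $c \in Z^1(\pi_1^{\mathrm{un}}(Z)_R, \pi_1^{\mathrm{PL}}(X)_R)^{\mathbb{G}_m}$ be a $\mathbb{G}_m$-equivariant polylogarithmic cocycle over a $\mathbb{Q}$-algebra $R$. For $0 \le r < n$, $\tau_1, \dots, \tau_r \in \Sigma_{ -1}$, and $\sigma \in \Sigma_{r-n}$, we have \[ \phi^{\sigma\tau_1\cdots\tau_r}_{\underbrace{e_1 e_0 \cdots e_0}_{n}}(c) = \phi^{\tau_1}_{e_0}(c) \cdots \phi^{\tau_r}_{e_0} (c)\, \phi^\sigma_{\underbrace{e_1 e_0\cdots e_0}_{n-r}}(c), \] and all other matrix entries $\phi_\lambda^w(c)$ (for $\lambda$ a polylogarithmic word and $w$ a word in $\Sigma$ of the same half-weight) vanish.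
   Context: Let $X=\mathbb{P}^1\setminus\{0,1,\infty\}$ and let $Z$ be an open integer scheme. Let $\pi_1^{\mathrm{un}}(Z)$ be the pro-unipotent radical of the mixed Tate Galois group $\pi_1^{\mathrm{MT}}(Z)=\pi_1^{\mathrm{un}}(Z)\rtimes\mathbb{G}_m$, with graded Lie algebra $\mathfrak{n}(Z)$ and coordinate ring $A(Z)$ (graded by half-weight). Fix an arbitrary family $\Sigma=\{\sigma_{n,i}\}$ of homogeneous free generators of $\mathfrak{n}(Z)$, with $\sigma_{n,i}$ in half-weight $-n$; write $\Sigma_{ -k}$ for the generators of degree $-k$. For each word $w$ in these generators, $f_w\in A(Z)$ denotes the dual (shuffle) basis element; $A(Z)$ carries the shuffle product and deconcatenation coproduct. The unipotent de Rham fundamental group $\pi_1^{\mathrm{un}}(X)$ (at base point $\vec{1}_0$) is free pro-unipotent on $e_0,e_1$ (dual to $dz/z$, $dz/(1-z)$), both in degree $-1$; for a word $\lambda$ in $e_0,e_1$, $\mathrm{Li}^{\mathfrak{u}}_\lambda$ denotes the dual basis element of its coordinate ring. The polylogarithmic words are $e_0$ and $e_1 e_0\cdots e_0$; one writes $\log^{\mathfrak{u}}=\mathrm{Li}^{\mathfrak{u}}_{e_0}$ and $\mathrm{Li}^{\mathfrak{u}}_n=\mathrm{Li}^{\mathfrak{u}}_{e_1e_0\cdots e_0}$ ($n$ letters). The polylogarithmic quotient $\pi_1^{\mathrm{PL}}(X)$ has coordinate ring the Hopf subalgebra generated by $\log^{\mathfrak{u}},\mathrm{Li}^{\mathfrak{u}}_1,\mathrm{Li}^{\mathfrak{u}}_2,\dots$,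 with (lexical path-composition convention) $\Delta'\log^{\mathfrak{u}}=0$ and $\Delta'\mathrm{Li}^{\mathfrak{u}}_n=\sum_{i=1}^{n-1}\mathrm{Li}^{\mathfrak{u}}_{n-i}\otimes(\log^{\mathfrak{u}})^{ш i}/i!$. Since $\pi_1^{\mathrm{un}}(Z)$ acts trivially on $\pi_1^{\mathrm{PL}}(X)$, a $\mathbb{G}_m$-equivariant cocycle $c$ is a $\mathbb{G}_m$-equivariant homomorphism, with associated algebra homomorphism $c^\sharp$ from the coordinate ring of $\pi_1^{\mathrm{PL}}(X)$ to $A(Z)\otimes R$. For a polylogarithmic word $\lambda$ of half-weight $-n$ and a word $w$ in $\Sigma$ of half-weight $-n$, $\phi^w_\lambda(c)$ denotes the corresponding matrix entry of $c^\sharp$, i.e. $\mathrm{Li}^{\mathfrak{u}}_\lambda(c):=c^\sharp(\mathrm{Li}^{\mathfrak{u}}_\lambda)=\sum_w\phi^w_\lambda(c)f_w$. -}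

module Defs where

open import Level using (Level; _⊔_) renaming (suc to lsuc)
open import Data.Nat using (ℕ; zero; suc; _∸_; _≤_; _<_)
open import Data.List using (List; []; _∷_; _++_; map; foldr; concatMap; upTo; length)
open import Data.List.Relation.Unary.All using (All)
open import Data.Product using (Σ; _×_; _,_)
open import Relation.Binary.PropositionalEquality using (_≡_; _≢_)
open import Algebra.Bundles using (CommutativeRing)

natR : ∀ {c ℓ} (K : CommutativeRing c ℓ) → ℕ → CommutativeRing.Carrier K
natR K zero    = CommutativeRing.0# K
natR K (suc n) = CommutativeRing._+_ K (CommutativeRing.1# K) (natR K n)

-- A ℚ-algebra: a commutative ring in which every positive integer n·1 is
-- invertible (such a ring carries a unique ℚ-algebra structure).
record QAlgebra (c ℓ : Level) : Set (lsuc (c ⊔ ℓ)) where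
  field
    cring : CommutativeRing c ℓ
  open CommutativeRing cring
  field
    inv       : ℕ → Carrier
    inv-right : ∀ n → natR cring (suc n) * inv n ≈ 1#

-- Setting: a graded set Gen of free generators σ of 𝔫(Z) (σ in half-weight
-- -(deg σ)), and a ℚ-algebra R.  Elements of A(Z) ⊗ R are represented by
-- their coefficients on the dual shuffle basis f_w, i.e. as functions
-- Word → R.
module Setup {a c ℓ : Level} (Gen : Set a) (deg : Gen → ℕ) (R : QAlgebra c ℓ) where
  open QAlgebra R public using (inv)
  open CommutativeRing (QAlgebra.cring R) public

  Word : Set a
  Word = List Gen

  -- half-weight of a word is minus this number
  weight : Word → ℕ
  weight w = foldr (λ s n → deg s Data.Nat.+ n) 0 w

  Elt : Set (a ⊔ c)
  Elt = Word → Carrier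

  sumR : List Carrier → Carrier
  sumR = foldr _+_ 0#

  prodR : List Carrier → Carrier
  prodR = foldr _*_ 1#

  splits : Word → List (Word × Word)
  splits []      = ([] , []) ∷ []
  splits (x ∷ w) = concatMap (λ { (u , v) → (x ∷ u , v) ∷ (u , x ∷ v) ∷ [] }) (splits w)

  -- shuffle product (f_u ш f_v = Σ_{w ∈ u ш v} f_w, dually)
  _ш_ : Elt → Elt → Elt
  (F ш G) w = sumR (map (λ { (u , v) → F u * G v }) (splits w))

  one : Elt
  one []      = 1#
  one (_ ∷ _) = 0#

  shPow : Elt → ℕ → Elt
  shPow F zero    = one
  shPow F (suc i) = F ш shPow F i

  invFact : ℕ → Carrier
  invFact zero    = 1#
  invFact (suc i) = inv i * invFact i

  -- A Gm-equivariant cocycle c : π₁^un(Z)_R → π₁^PL(X)_R, given through the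
  -- images under c♯ of the free algebra generators log^u and Li^u_n (n ≥ 1)
  -- of O(π₁^PL(X)):  L = c♯(log^u),  P n = c♯(Li^u_n).  Gm-equivariance =
  -- homogeneity of the right weight; being a group homomorphism = compatibility
  -- with the (reduced) coproducts, Δ' on A(Z) being reduced deconcatenation.
  record PolylogCocycle : Set (a ⊔ c ⊔ ℓ) where
    field
      L : Elt
      P : ℕ → Elt
      L-homog : ∀ w → weight w ≢ 1 → L w ≈ 0#
      P-homog : ∀ n → 1 ≤ n → ∀ w → weight w ≢ n → P n w ≈ 0#
      -- Δ' log^u = 0
      L-coprod : ∀ u v → u ≢ [] → v ≢ [] → L (u ++ v) ≈ 0#
      -- Δ' Li^u_n = Σ_{i=1}^{n-1} Li^u_{n-i} ⊗ (log^u)^{ш i} / i!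
      P-coprod : ∀ n → 1 ≤ n → ∀ u v → u ≢ [] → v ≢ [] →
        P n (u ++ v) ≈
          sumR (map (λ i → P (n ∸ i) u * (invFact i * shPow L i v))
                    (map suc (upTo (n ∸ 1))))

  φ-log : PolylogCocycle → Word → Carrier
  φ-log C w = PolylogCocycle.L C w

  φ-Li : PolylogCocycle → ℕ → Word → Carrier
  φ-Li C n w = PolylogCocycle.P C n w

  PolyShape : Word → Set a
  PolyShape w = Σ Gen λ σ → Σ Word λ τs → (w ≡ σ ∷ τs) × All (λ t → deg t ≡ 1) τs

{-# OPTIONS --safe #-}
module Submission where

-- Since Δ' log = 0, c♯(log) is supported on single letters, so its i-th shuffle
-- power is i! times the product of its values on the letters of a word of
-- length i, and zero on all other words.  Splitting off the first letter σ in the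
-- coproduct formula for Li_n therefore leaves only the summand i = r, which is
-- the stated product; when some later letter has degree ≠ 1, homogeneity of
-- c♯(log) kills that summand too.

open import Defs
open import Level using (Level; _⊔_)
open import Data.Nat using (ℕ; zero; suc; _∸_; _≤_; _<_; z≤n; s≤s) renaming (_+_ to _+ℕ_)
open import Data.Nat.Properties using (suc-injective; +-suc) renaming (+-identityʳ to +-identityʳℕ; _≟_ to _≟ℕ_)
open import Data.List using (List; []; _∷_; map; foldr; length; concatMap; upTo; applyUpTo)
open import Data.List.Properties using (map-∘; map-applyUpTo)
open import Data.List.Relation.Unary.All using (All; []; _∷_)
open import Data.Product using (_×_; _,_; proj₁; proj₂)
open import Data.Empty using (⊥-elim)
open import Function using (_∘_; id)
open import Relation.Binary.PropositionalEquality as P using (_≡_; _≢_)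
open import Relation.Nullary using (¬_; yes; no)
open import Algebra.Bundles using (CommutativeRing)

module RingLemmas {c ℓ} (K : CommutativeRing c ℓ) where
  open CommutativeRing K
  open import Relation.Binary.Reasoning.Setoid setoid
  open import Algebra.Properties.CommutativeSemigroup +-commutativeSemigroup
    using () renaming (interchange to +-interchange)

  sum : List Carrier → Carrier
  sum = foldr _+_ 0#

  x≈0⇒y*x≈0 : ∀ {x y} → x ≈ 0# → y * x ≈ 0#
  x≈0⇒y*x≈0 {y = y} x≈0 = trans (*-congˡ x≈0) (zeroʳ y)

  sum-map-zero : ∀ {a} {A : Set a} (f : A → Carrier) → (∀ x → f x ≈ 0#) →
    ∀ xs → sum (map f xs) ≈ 0#
  sum-map-zero f f≈0 []       = refl
  sum-map-zero f f≈0 (x ∷ xs) = trans (+-cong (f≈0 x) (sum-map-zero f f≈0 xs)) (+-identityʳ 0#)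

  sum-map-concatMap-pair : ∀ {a b} {A : Set a} {B : Set b} (g h : A → B) (f : B → Carrier) xs →
    sum (map f (concatMap (λ x → g x ∷ h x ∷ []) xs)) ≈ sum (map (f ∘ g) xs) + sum (map (f ∘ h) xs)
  sum-map-concatMap-pair g h f []       = sym (+-identityʳ 0#)
  sum-map-concatMap-pair g h f (x ∷ xs) = begin
    f (g x) + (f (h x) + sum (map f (concatMap (λ x → g x ∷ h x ∷ []) xs)))
      ≈⟨ +-congˡ (+-congˡ (sum-map-concatMap-pair g h f xs)) ⟩
    f (g x) + (f (h x) + (sum (map (f ∘ g) xs) + sum (map (f ∘ h) xs)))
      ≈⟨ sym (+-assoc _ _ _) ⟩
    (f (g x) + f (h x)) + (sum (map (f ∘ g) xs) + sum (map (f ∘ h) xs))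
      ≈⟨ +-interchange _ _ _ _ ⟩
    (f (g x) + sum (map (f ∘ g) xs)) + (f (h x) + sum (map (f ∘ h) xs)) ∎

  sum-applyUpTo-zero : ∀ (f : ℕ → Carrier) → (∀ i → f i ≈ 0#) → ∀ m → sum (applyUpTo f m) ≈ 0#
  sum-applyUpTo-zero f f≈0 m =
    trans (reflexive (P.cong sum (P.sym (map-applyUpTo id f m)))) (sum-map-zero f f≈0 (upTo m))

  sum-applyUpTo-single : ∀ (f : ℕ → Carrier) {m j} → j < m → (∀ i → i ≢ j → f i ≈ 0#) →
    sum (applyUpTo f m) ≈ f j
  sum-applyUpTo-single f {suc m} {zero} _ f≈0 =
    trans (+-congˡ (sum-applyUpTo-zero (f ∘ suc) (λ i → f≈0 (suc i) (λ ())) m)) (+-identityʳ (f 0))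
  sum-applyUpTo-single f {suc m} {suc j} (s≤s j<m) f≈0 =
    trans (+-cong (f≈0 0 (λ ()))
                  (sum-applyUpTo-single (f ∘ suc) j<m (λ i i≢j → f≈0 (suc i) (i≢j ∘ suc-injective))))
          (+-identityˡ (f (suc j)))

module _ {a c ℓ : Level} (Gen : Set a) (deg : Gen → ℕ) (R : QAlgebra c ℓ) where
  open Setup Gen deg R
  open QAlgebra R using (cring; inv-right)
  open RingLemmas cring
    using (x≈0⇒y*x≈0; sum-map-zero; sum-map-concatMap-pair; sum-applyUpTo-zero; sum-applyUpTo-single)
  open import Relation.Binary.Reasoning.Setoid setoid
  open import Algebra.Properties.CommutativeSemigroup *-commutativeSemigroup
    using () renaming (interchange to *-interchange; x∙yz≈y∙xz to x*yz≈y*xz)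

  factorial : ℕ → Carrier
  factorial zero    = 1#
  factorial (suc i) = natR cring (suc i) * factorial i

  invFact-factorial : ∀ i → invFact i * factorial i ≈ 1#
  invFact-factorial zero    = *-identityʳ 1#
  invFact-factorial (suc i) = begin
    (inv i * invFact i) * (natR cring (suc i) * factorial i) ≈⟨ *-interchange _ _ _ _ ⟩
    (inv i * natR cring (suc i)) * (invFact i * factorial i)
      ≈⟨ *-cong (trans (*-comm _ _) (inv-right i)) (invFact-factorial i) ⟩
    1# * 1#                                                  ≈⟨ *-identityʳ 1# ⟩
    1#                                                       ∎

  consˡ consʳ : Gen → Word × Word → Word × Word
  consˡ x (u , v) = x ∷ u , v
  consʳ x (u , v) = u , x ∷ v

  sumR-splits-∷ : ∀ (f : Word × Word → Carrier) x w → sumR (map f (splits (x ∷ w))) ≈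
    sumR (map (f ∘ consˡ x) (splits w)) + sumR (map (f ∘ consʳ x) (splits w))
  sumR-splits-∷ f x w = sum-map-concatMap-pair (consˡ x) (consʳ x) f (splits w)

  sumR-splits-emptyˡ : (f : Word × Word → Carrier) → (∀ x u v → f (x ∷ u , v) ≈ 0#) →
    ∀ w → sumR (map f (splits w)) ≈ f ([] , w)
  sumR-splits-emptyˡ f f≈0 []      = +-identityʳ (f ([] , []))
  sumR-splits-emptyˡ f f≈0 (y ∷ w) = begin
    sumR (map f (splits (y ∷ w)))                                         ≈⟨ sumR-splits-∷ f y w ⟩
    sumR (map (f ∘ consˡ y) (splits w)) + sumR (map (f ∘ consʳ y) (splits w))
      ≈⟨ +-cong (sum-map-zero (f ∘ consˡ y) (λ p → f≈0 y (proj₁ p) (proj₂ p)) (splits w))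
                (sumR-splits-emptyˡ (f ∘ consʳ y) (λ x u v → f≈0 x u (y ∷ v)) w) ⟩
    0# + f ([] , y ∷ w)                                                   ≈⟨ +-identityˡ _ ⟩
    f ([] , y ∷ w)                                                        ∎

  LetterSupported : Elt → Set (a ⊔ ℓ)
  LetterSupported F = ∀ u → length u ≢ 1 → F u ≈ 0#

  prodLetters : Elt → Word → Carrier
  prodLetters F w = prodR (map (λ t → F (t ∷ [])) w)

  module _ {F : Elt} (F-letters : LetterSupported F) where

    ш-[] : ∀ G → (F ш G) [] ≈ 0#
    ш-[] G = trans (+-identityʳ _) (trans (*-congʳ (F-letters [] (λ ()))) (zeroˡ (G [])))

    ш-∷ : ∀ G x w → (F ш G) (x ∷ w) ≈ F (x ∷ []) * G w + (F ш (G ∘ (x ∷_))) w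
    ш-∷ G x w = begin
      (F ш G) (x ∷ w)                                                        ≈⟨ sumR-splits-∷ _ x w ⟩
      sumR (map (λ p → F (x ∷ proj₁ p) * G (proj₂ p)) (splits w)) + (F ш (G ∘ (x ∷_))) w
        ≈⟨ +-congʳ (sumR-splits-emptyˡ _ F-longWord≈0 w) ⟩
      F (x ∷ []) * G w + (F ш (G ∘ (x ∷_))) w ∎
      where
      F-longWord≈0 : ∀ y u v → F (x ∷ y ∷ u) * G v ≈ 0#
      F-longWord≈0 y u v = trans (*-congʳ (F-letters (x ∷ y ∷ u) (λ ()))) (zeroˡ (G v))

    -- The offset k counts the letters already stripped off by ш-∷, which lets the
    -- induction on w replace G by G ∘ (x ∷_).
    ш-vanishes : ∀ k N G → (∀ u → k +ℕ length u ≢ N → G u ≈ 0#) →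
      ∀ w → k +ℕ length w ≢ suc N → (F ш G) w ≈ 0#
    ш-vanishes k N G G≈0 []      _  = ш-[] G
    ш-vanishes k N G G≈0 (x ∷ w) ≢N = begin
      (F ш G) (x ∷ w)                          ≈⟨ ш-∷ G x w ⟩
      F (x ∷ []) * G w + (F ш (G ∘ (x ∷_))) w
        ≈⟨ +-cong (x≈0⇒y*x≈0 (G≈0 w (λ ≡N → ≢N (P.trans (+-suc k _) (P.cong suc ≡N)))))
                  (ш-vanishes (suc k) N (G ∘ (x ∷_)) G′≈0 w (≢N ∘ P.trans (+-suc k _))) ⟩
      0# + 0#                                  ≈⟨ +-identityʳ 0# ⟩
      0#                                       ∎
      where
      G′≈0 : ∀ u → suc k +ℕ length u ≢ N → G (x ∷ u) ≈ 0#
      G′≈0 u ≢N′ = G≈0 (x ∷ u) (≢N′ ∘ P.trans (P.sym (+-suc k _)))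

    ш-value : ∀ k N G c₀ → (∀ u → k +ℕ length u ≡ N → G u ≈ c₀ * prodLetters F u) →
      ∀ w → k +ℕ length w ≡ suc N → (F ш G) w ≈ natR cring (length w) * (c₀ * prodLetters F w)
    ш-value k N G c₀ G≈ []      _  = trans (ш-[] G) (sym (zeroˡ _))
    ш-value k N G c₀ G≈ (x ∷ w) ≡N = begin
      (F ш G) (x ∷ w)                                             ≈⟨ ш-∷ G x w ⟩
      Fx * G w + (F ш (G ∘ (x ∷_))) w
        ≈⟨ +-cong (*-congˡ (G≈ w (suc-injective (P.trans (P.sym (+-suc k _)) ≡N))))
                  (ш-value (suc k) N (G ∘ (x ∷_)) (c₀ * Fx) G′≈ w (P.trans (P.sym (+-suc k _)) ≡N)) ⟩
      Fx * (c₀ * Π) + n * ((c₀ * Fx) * Π)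
        ≈⟨ +-cong (x*yz≈y*xz _ _ _) (*-congˡ (*-assoc _ _ _)) ⟩
      c₀ * (Fx * Π) + n * (c₀ * (Fx * Π))                         ≈⟨ +-congʳ (sym (*-identityˡ _)) ⟩
      1# * (c₀ * (Fx * Π)) + n * (c₀ * (Fx * Π))                  ≈⟨ sym (distribʳ _ _ _) ⟩
      (1# + n) * (c₀ * (Fx * Π))                                  ∎
      where
      Fx = F (x ∷ [])
      Π  = prodLetters F w
      n  = natR cring (length w)
      G′≈ : ∀ u → suc k +ℕ length u ≡ N → G (x ∷ u) ≈ (c₀ * Fx) * prodLetters F u
      G′≈ u ≡N′ = trans (G≈ (x ∷ u) (P.trans (+-suc k _) ≡N′)) (sym (*-assoc _ _ _))

    shPow-vanishes : ∀ i v → length v ≢ i → shPow F i v ≈ 0#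
    shPow-vanishes zero    []      ≢0 = ⊥-elim (≢0 P.refl)
    shPow-vanishes zero    (_ ∷ _) _  = refl
    shPow-vanishes (suc i) v       ≢i = ш-vanishes 0 i (shPow F i) (shPow-vanishes i) v ≢i

    shPow-value : ∀ i v → length v ≡ i → shPow F i v ≈ factorial i * prodLetters F v
    shPow-value zero    []      _  = sym (*-identityˡ 1#)
    shPow-value (suc i) v       ≡i = begin
      shPow F (suc i) v
        ≈⟨ ш-value 0 i (shPow F i) (factorial i) (shPow-value i) v ≡i ⟩
      natR cring (length v) * (factorial i * Π)      ≈⟨ sym (*-assoc _ _ _) ⟩
      (natR cring (length v) * factorial i) * Π      ≡⟨ P.cong (λ m → (natR cring m * factorial i) * Π) ≡i ⟩
      factorial (suc i) * Π                          ∎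
      where Π = prodLetters F v

    invFact-shPow : ∀ i v → length v ≡ i → invFact i * shPow F i v ≈ prodLetters F v
    invFact-shPow i v ≡i = begin
      invFact i * shPow F i v                 ≈⟨ *-congˡ (shPow-value i v ≡i) ⟩
      invFact i * (factorial i * Π)           ≈⟨ sym (*-assoc _ _ _) ⟩
      (invFact i * factorial i) * Π           ≈⟨ *-congʳ (invFact-factorial i) ⟩
      1# * Π                                  ≈⟨ *-identityˡ Π ⟩
      Π                                       ∎
      where Π = prodLetters F v

    invFact-shPow-vanishes : ∀ v → prodLetters F v ≈ 0# → ∀ i → invFact i * shPow F i v ≈ 0#
    invFact-shPow-vanishes v Π≈0 i with length v ≟ℕ i
    ... | yes ≡i = trans (invFact-shPow i v ≡i) Π≈0
    ... | no  ≢i = x≈0⇒y*x≈0 (shPow-vanishes i v ≢i)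

  module _ (C : PolylogCocycle) where
    open PolylogCocycle C

    L-letterSupported : LetterSupported L
    L-letterSupported []          _  = L-homog [] (λ ())
    L-letterSupported (_ ∷ [])    ≢1 = ⊥-elim (≢1 P.refl)
    L-letterSupported (x ∷ y ∷ w) _  = L-coprod (x ∷ []) (y ∷ w) (λ ()) (λ ())

    prodLetters-L-vanishes : ∀ v → ¬ All (λ t → deg t ≡ 1) v → prodLetters L v ≈ 0#
    prodLetters-L-vanishes []      ¬all = ⊥-elim (¬all [])
    prodLetters-L-vanishes (t ∷ v) ¬all with deg t ≟ℕ 1
    ... | yes deg≡1 = x≈0⇒y*x≈0 (prodLetters-L-vanishes v (¬all ∘ (deg≡1 ∷_)))
    ... | no  deg≢1 = trans (*-congʳ L[t]≈0) (zeroˡ _)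
      where
      L[t]≈0 : L (t ∷ []) ≈ 0#
      L[t]≈0 = L-homog (t ∷ []) (deg≢1 ∘ P.trans (P.sym (+-identityʳℕ (deg t))))

    P-∷ : ∀ n σ τs → τs ≢ [] → P (suc n) (σ ∷ τs) ≈
      sumR (applyUpTo (λ j → P (n ∸ j) (σ ∷ []) * (invFact (suc j) * shPow L (suc j) τs)) n)
    P-∷ n σ τs τs≢[] = trans (P-coprod (suc n) (s≤s z≤n) (σ ∷ []) τs (λ ()) τs≢[])
      (reflexive (P.cong sumR (P.trans (P.sym (map-∘ (upTo n))) (map-applyUpTo id _ n))))

    P-polyShape : ∀ n σ τs → length τs < n →
      P n (σ ∷ τs) ≈ prodLetters L τs * P (n ∸ length τs) (σ ∷ [])
    P-polyShape n       σ []          _         = sym (*-identityˡ _)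
    P-polyShape (suc n) σ τs@(_ ∷ ts) (s≤s r<n) = begin
      P (suc n) (σ ∷ τs)                ≈⟨ P-∷ n σ τs (λ ()) ⟩
      sumR (applyUpTo term n)           ≈⟨ sum-applyUpTo-single term r<n off-diagonal ⟩
      term (length ts)                  ≈⟨ *-congˡ (invFact-shPow L-letterSupported (length τs) τs P.refl) ⟩
      Pσ * prodLetters L τs             ≈⟨ *-comm _ _ ⟩
      prodLetters L τs * Pσ             ∎
      where
      Pσ = P (n ∸ length ts) (σ ∷ [])
      term : ℕ → Carrier
      term j = P (n ∸ j) (σ ∷ []) * (invFact (suc j) * shPow L (suc j) τs)
      off-diagonal : ∀ j → j ≢ length ts → term j ≈ 0#
      off-diagonal j j≢r = x≈0⇒y*x≈0 (x≈0⇒y*x≈0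
        (shPow-vanishes L-letterSupported (suc j) τs (j≢r ∘ P.sym ∘ suc-injective)))

    P-nonPolyShape : ∀ n → 1 ≤ n → ∀ w → ¬ PolyShape w → P n w ≈ 0#
    P-nonPolyShape (suc n) 1≤n []               _      = P-homog (suc n) 1≤n [] (λ ())
    P-nonPolyShape (suc n) _   (σ ∷ [])         ¬shape = ⊥-elim (¬shape (σ , [] , P.refl , []))
    P-nonPolyShape (suc n) _   (σ ∷ τs@(_ ∷ _)) ¬shape = trans (P-∷ n σ τs (λ ()))
      (sum-applyUpTo-zero _ (λ j → x≈0⇒y*x≈0 (invFact-shPow-vanishes L-letterSupported τs Π≈0 (suc j))) n)
      where
      Π≈0 : prodLetters L τs ≈ 0#
      Π≈0 = prodLetters-L-vanishes τs (λ all≡1 → ¬shape (σ , τs , P.refl , all≡1))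

proposition3p9 : ∀ {a c ℓ : Level} (Gen : Set a) (deg : Gen → ℕ)
    (deg-pos : ∀ s → 1 ≤ deg s) (R : QAlgebra c ℓ) →
    let open Setup Gen deg R in
    (C : PolylogCocycle) →
      (∀ (n : ℕ) (τs : List Gen) → length τs < n → All (λ t → deg t ≡ 1) τs →
        ∀ (σ : Gen) → deg σ ≡ n ∸ length τs →
        φ-Li C n (σ ∷ τs) ≈ prodR (map (λ t → φ-log C (t ∷ [])) τs) * φ-Li C (n ∸ length τs) (σ ∷ []))
      × (∀ (n : ℕ) → 1 ≤ n → ∀ (w : Word) → weight w ≡ n → ¬ PolyShape w → φ-Li C n w ≈ 0#)
proposition3p9 Gen deg _ R C =
    (λ n τs r<n _ σ _ → P-polyShape Gen deg R C n σ τs r<n)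
  , (λ n 1≤n w _ → P-nonPolyShape Gen deg R C n 1≤n w)
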